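{- Let $T$ be an oriented tree and $H$ a digraph such that there is no homomorphism $T\to H$. If $S$ is a sproink of $T$ (as defined in the context), then there is no homomorphism $S\to\delta H$.
   Context: Digraphs and homomorphisms as usual. An oriented tree is a digraph whose underlying undirected graph is a tree. The arc graph of $H=(V,A)$ is $\delta H=(A,\delta A)$ with $\delta A=\{((u,v),(v,w)) : (u,v),(v,w)\in A\}$. A tree $F$ has height at most one if its vertex set can be partitioned into two sets $0_F,1_F$ such that every arc $(x,y)$ of $F$ has $x\in 0_F$ and $y\in 1_F$ (if $F$ has no arcs it is a single vertex, one of the sets being empty). Sproinks: let $T$ be an oriented tree. For every vertex $u$ of $T$ choose a tree $F(u)$ of height at most one (with a fixed partition $0_{F(u)},1_{F(u)}$), and for every arc $e$ of $T$ incident with $u$ choose a vertex $v(e,F(u))$ of $F(u)$ such that $v(e,F(u))\in 1_{F(u)}$ if $u$ is the initial vertex of $e$ and $v(e,F(u))\in 0_{F(u)}$ if $u$ is the terminal vertex of $e$. The tree $S$ obtained from the disjoint union of all $F(u)$, $u\in V(T)$, by identifying $v(e,F(u))$ with $v(e,F(u'))$ for every arc $e=(u,u')$ of $T$ is called a sproink of $T$. -}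

module Defs where

open import Data.Nat using (ℕ; _≤_; suc)
open import Data.Fin using (Fin)
open import Data.Bool using (Bool; true; false; T)
open import Data.Product using (Σ; _×_; _,_; proj₁; proj₂)
open import Data.Sum using (_⊎_)
open import Data.List using (List; []; _∷_; _∷ʳ_; length)
open import Data.List.Relation.Unary.Linked using (Linked)
open import Data.List.Relation.Unary.Unique.Propositional using (Unique)
open import Relation.Nullary using (¬_)
open import Relation.Binary.PropositionalEquality using (_≡_)

record Digraph : Set₁ where
  field
    V : Set
    A : V → V → Set
open Digraph public

Hom : Digraph → Digraph → Set
Hom G H = Σ (V G → V H) λ f → ∀ {x y} → A G x y → A H (f x) (f y)

finDigraph : (n : ℕ) → (Fin n → Fin n → Bool) → Digraph
finDigraph n adj = record { V = Fin n ; A = λ x y → T (adj x y) }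

δ : Digraph → Digraph
δ H = record
  { V = Σ (V H × V H) (λ p → A H (proj₁ p) (proj₂ p))
  ; A = λ e f → proj₂ (proj₁ e) ≡ proj₁ (proj₁ f)
  }

module _ {n : ℕ} (adj : Fin n → Fin n → Bool) where

  UAdj : Fin n → Fin n → Set
  UAdj x y = T (adj x y) ⊎ T (adj y x)

  data Walk : Fin n → Fin n → Set where
    here : ∀ {x} → Walk x x
    step : ∀ {x y z} → UAdj x y → Walk y z → Walk x z

  Connected : Set
  Connected = ∀ x y → Walk x y

  IsCycle : Fin n → List (Fin n) → Fin n → Set
  IsCycle x ys z =
    (1 ≤ length ys) × Unique (x ∷ (ys ∷ʳ z)) ×
    Linked UAdj (x ∷ (ys ∷ʳ z)) × UAdj z x

  Acyclic : Set
  Acyclic = ∀ x ys z → ¬ IsCycle x ys z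

  record IsOrientedTree : Set where
    field
      nonempty  : 1 ≤ n
      loopless  : ∀ x → ¬ T (adj x x)
      oriented  : ∀ x y → T (adj x y) → ¬ T (adj y x)
      connected : Connected
      acyclic   : Acyclic

-- Sproinks of the oriented tree T = (Fin n, adj).
-- Boolean side: false = 0_F, true = 1_F.

record Sproink (n : ℕ) (adj : Fin n → Fin n → Bool) : Set where
  field
    m      : Fin n → ℕ
    fadj   : (u : Fin n) → Fin (m u) → Fin (m u) → Bool
    ftree  : ∀ u → IsOrientedTree (fadj u)
    side   : (u : Fin n) → Fin (m u) → Bool
    height : ∀ u x y → T (fadj u x y) → (side u x ≡ false) × (side u y ≡ true)
    vout     : ∀ {a b} → T (adj a b) → Fin (m a)
    vout-side : ∀ {a b} (e : T (adj a b)) → side a (vout e) ≡ true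
    vin      : ∀ {a b} → T (adj a b) → Fin (m b)
    vin-side : ∀ {a b} (e : T (adj a b)) → side b (vin e) ≡ false

-- The sproink S is the quotient of the disjoint union Σ u. F(u) by the
-- equivalence generated by  (a, vout e) ~ (b, vin e)  for arcs e = (a,b) of T,
-- with arcs the images of arcs of the F(u).  A homomorphism S → G is thus
-- exactly a map on the disjoint union that identifies the glued vertices
-- and preserves all arcs of every F(u).
SproinkHom : ∀ {n adj} → Sproink n adj → Digraph → Set
SproinkHom {n} {adj} S G =
  Σ ((u : Fin n) → Fin (m u) → V G) λ g →
    (∀ u x y → T (fadj u x y) → A G (g u x) (g u y)) ×
    (∀ a b (e : T (adj a b)) → g a (vout e) ≡ g b (vin e))
  where open Sproink S

-- A homomorphism g : S → δH sends each vertex of a tree F(u) to an arc of H.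
-- Reading off the tail of g x for x ∈ 1_F and the head of g x for x ∈ 0_F
-- contracts every arc (x, y) of F(u) to a single vertex of H, because g x and
-- g y are consecutive arcs.  Since F(u) is connected, all of F(u) goes to one
-- vertex f u of H.  For an arc e = (a, b) of T, the glued vertex
-- v(e,F(a)) = v(e,F(b)) lies in 1_F(a) and in 0_F(b), so f a and f b are the
-- tail and the head of the same arc of H: f is a homomorphism T → H.
module Submission where

open import Defs
open import Data.Nat using (ℕ; suc; _≤_)
open import Data.Fin using (Fin; zero)
open import Data.Bool using (Bool; true; false; T)
open import Data.Product using (_,_; proj₁; proj₂)
open import Data.Sum using (inj₁; inj₂)
open import Relation.Nullary using (¬_)
open import Relation.Binary.PropositionalEquality
  using (_≡_; refl; sym; trans; cong; subst₂; module ≡-Reasoning)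

tail head : ∀ {H} → V (δ H) → V H
tail e = proj₁ (proj₁ e)
head e = proj₂ (proj₁ e)

endpoint : ∀ {H} → Bool → V (δ H) → V H
endpoint true  = tail
endpoint false = head

Fin-inhabited : ∀ {m} → 1 ≤ m → Fin m
Fin-inhabited {suc _} _ = zero

module _ {m : ℕ} {fadj : Fin m → Fin m → Bool} {X : Set} (φ : Fin m → X)
         (φ-arc : ∀ {x y} → T (fadj x y) → φ x ≡ φ y) where

  walk-preserves : ∀ {x y} → Walk fadj x y → φ x ≡ φ y
  walk-preserves here                = refl
  walk-preserves (step (inj₁ xy) w) = trans (φ-arc xy) (walk-preserves w)
  walk-preserves (step (inj₂ yx) w) = trans (sym (φ-arc yx)) (walk-preserves w)

module _ {n : ℕ} {adj : Fin n → Fin n → Bool} (S : Sproink n adj) {H : Digraph}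
         (h : SproinkHom S (δ H)) where
  open Sproink S

  private
    g = proj₁ h

  contract : (u : Fin n) → Fin (m u) → V H
  contract u x = endpoint (side u x) (g u x)

  contract-arc : ∀ u {x y} → T (fadj u x y) → contract u x ≡ contract u y
  contract-arc u {x} {y} xy with height u x y xy
  ... | sx , sy rewrite sx | sy = proj₁ (proj₂ h) u x y xy

  sproinkHom⇒hom : (∀ u → 1 ≤ m u) → (∀ u → Connected (fadj u)) →
                   Hom (finDigraph n adj) H
  sproinkHom⇒hom nonempty connected = f , f-arc
    where
    root : ∀ u → Fin (m u)
    root u = Fin-inhabited (nonempty u)

    f : Fin n → V H
    f u = contract u (root u)

    f-constant : ∀ u x → f u ≡ contract u x
    f-constant u x = walk-preserves (contract u) (contract-arc u) (connected u (root u) x)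

    f-arc : ∀ {a b} → T (adj a b) → A H (f a) (f b)
    f-arc {a} {b} e = subst₂ (A H) (sym f-tail) (sym f-head) (proj₂ (g a (vout e)))
      where
      open ≡-Reasoning
      f-tail : f a ≡ tail (g a (vout e))
      f-tail = begin
        f a                                        ≡⟨ f-constant a (vout e) ⟩
        endpoint (side a (vout e)) (g a (vout e))  ≡⟨ cong (λ s → endpoint s (g a (vout e))) (vout-side e) ⟩
        tail (g a (vout e))                        ∎
      f-head : f b ≡ head (g a (vout e))
      f-head = begin
        f b                                        ≡⟨ f-constant b (vin e) ⟩
        endpoint (side b (vin e)) (g b (vin e))    ≡⟨ cong (λ s → endpoint s (g b (vin e))) (vin-side e) ⟩
        head (g b (vin e))                         ≡⟨ cong head (sym (proj₂ (proj₂ h) a b e)) ⟩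
        head (g a (vout e))                        ∎

lemma2 : (n : ℕ) (adj : Fin n → Fin n → Bool) → IsOrientedTree adj →
         (k : ℕ) (hadj : Fin k → Fin k → Bool) →
         ¬ Hom (finDigraph n adj) (finDigraph k hadj) →
         (S : Sproink n adj) →
         ¬ SproinkHom S (δ (finDigraph k hadj))
lemma2 n adj _ k hadj noHom S h =
  noHom (sproinkHom⇒hom S h (λ u → nonempty (ftree u)) (λ u → connected (ftree u)))
  where
  open Sproink S using (ftree)
  open IsOrientedTree
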